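{- Let $(b_k)_{k\ge1}$, $(c_k)_{k\ge1}$ be sequences of complex numbers, $|z|,|t|,|q|<1$, and $$\prod_{k=1}^\infty\frac{1}{(1-zq^k)^{b_k}}\prod_{k=1}^\infty\frac{1}{(1-tq^k)^{c_k}}=\sum_{n\ge0}P(n)q^n,$$ so that $P(n)=\sum_{(\pi,\mu)}\prod_i\frac{(b_i)_{r_i}}{r_i!}z^{r_i}\prod_j\frac{(c_j)_{s_j}}{s_j!}t^{s_j}$, the sum over pairs of partitions $\pi=\sum_ir_iu_i$, $\mu=\sum_js_jv_j$ with $|\pi|+|\mu|=n$. Let $F^z_k(n)$ be the same sum restricted to pairs with $r_k>0$ and with each term multiplied by $r_k$, and $F^t_k(n)$ the same sum restricted to pairs with $s_k>0$ and each term multiplied by $s_k$. Then for all $n\ge1$: (a) for each $i=1,\dots,n$, $\displaystyle F^z_i(n)+F^t_i(n)=\sum_{j=1}^n a_i(j)P(n-j)$, where $a_i(j)=b_iz^r+c_it^r$ if $j=ri$ for some integer $r\ge1$, and $a_i(j)=0$ otherwise; (b) equivalently with a $2n\times n$ matrix: for each $s=1,\dots,n$, $\displaystyle F^z_s(n)=\sum_{j=1}^n a_{2s-1}(j)P(n-j)$ and $\displaystyle F^t_s(n)=\sum_{j=1}^n a_{2s}(j)P(n-j)$, where $a_{2s-1}(j)=b_sz^r$ and $a_{2s}(j)=c_st^r$ if $j=rs$ for some integer $r\ge1$, and both are $0$ otherwise.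
   Context: Partitions are written $\pi=\sum_ir_iu_i$ meaning part $i$ occurs $r_i$ times; $|\pi|=\sum_i ir_i$. $(a)_0=1$, $(a)_r=a(a+1)\cdots(a+r-1)$. -}

module Defs where

open import Algebra.Bundles using (CommutativeRing)
open import Data.Nat as ℕ using (ℕ; zero; suc; _!)
open import Data.Bool using (Bool; true; false; if_then_else_)
open import Data.List using (List; []; _∷_; [_]; map; concatMap; foldr; upTo)
open import Data.Vec as Vec using (Vec)
open import Data.Maybe using (Maybe; just; nothing)
open import Data.Product using (_×_; _,_)

-- Multiplicity vectors (r_k, r_{k+1}, ..., r_{k+len-1}) of parts k..k+len-1
-- (k ≥ 1) with total weight  Σ_i i * r_i = w.
multVecs : ℕ → (len : ℕ) → ℕ → List (Vec ℕ len)
multVecs k zero w = if w ℕ.≡ᵇ 0 then [ Vec.[] ] else []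
multVecs k (suc len) w =
  concatMap (λ r → if r ℕ.* k ℕ.≤ᵇ w
                     then map (r Vec.∷_) (multVecs (suc k) len (w ℕ.∸ r ℕ.* k))
                     else [])
            (upTo (suc w))

-- All partitions π = Σ_i r_i u_i of m, with parts ≤ n, written as their
-- multiplicity vector (r_1, ..., r_n).  For m ≤ n this is every partition of m.
partitions : (n m : ℕ) → List (Vec ℕ n)
partitions n m = multVecs 1 n m

pairs : (n : ℕ) → List (Vec ℕ n × Vec ℕ n)
pairs n = concatMap (λ m → concatMap (λ π → map (π ,_) (partitions n (n ℕ.∸ m)))
                                      (partitions n m))
                    (upTo (suc n))

-- the multiplicity r_k of part k (k ≥ 1) in a multiplicity vector (0 if out of range)
mult : ∀ {n} → Vec ℕ n → ℕ → ℕ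
mult Vec.[] k = 0
mult (r Vec.∷ rs) zero = 0
mult (r Vec.∷ rs) (suc zero) = r
mult (r Vec.∷ rs) (suc (suc k)) = mult rs (suc k)

quotIndex : (i j : ℕ) → Maybe ℕ
quotIndex i j = go (map suc (upTo j))
  where
  go : List ℕ → Maybe ℕ
  go [] = nothing
  go (r ∷ rs) = if r ℕ.* i ℕ.≡ᵇ j then just r else go rs

-- Ring-valued notions. invFact r is meant to be the inverse of r! in R.
module WithRing {c ℓ} (R : CommutativeRing c ℓ) (invFact : ℕ → CommutativeRing.Carrier R) where
  open CommutativeRing R

  ι : ℕ → Carrier
  ι zero = 0#
  ι (suc n) = 1# + ι n

  pow : Carrier → ℕ → Carrier
  pow x zero = 1#
  pow x (suc n) = x * pow x n

  rising : Carrier → ℕ → Carrier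
  rising a zero = 1#
  rising a (suc r) = rising a r * (a + ι r)

  sumL : List Carrier → Carrier
  sumL = foldr _+_ 0#

  weight : (ℕ → Carrier) → Carrier → ℕ → ∀ {len} → Vec ℕ len → Carrier
  weight b z k Vec.[] = 1#
  weight b z k (r Vec.∷ rs) = (rising (b k) r * invFact r) * pow z r * weight b z (suc k) rs

  term : (b c : ℕ → Carrier) (z t : Carrier) → ∀ {n} → Vec ℕ n × Vec ℕ n → Carrier
  term b c z t (π , μ) = weight b z 1 π * weight c t 1 μ

  P : (b c : ℕ → Carrier) (z t : Carrier) → ℕ → Carrier
  P b c z t n = sumL (map (term b c z t) (pairs n))

  Fz : (b c : ℕ → Carrier) (z t : Carrier) → ℕ → ℕ → Carrier
  Fz b c z t k n = sumL (map f (pairs n))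
    where
    f : Vec ℕ n × Vec ℕ n → Carrier
    f (π , μ) = if mult π k ℕ.≡ᵇ 0 then 0# else ι (mult π k) * term b c z t (π , μ)

  Ft : (b c : ℕ → Carrier) (z t : Carrier) → ℕ → ℕ → Carrier
  Ft b c z t k n = sumL (map f (pairs n))
    where
    f : Vec ℕ n × Vec ℕ n → Carrier
    f (π , μ) = if mult μ k ℕ.≡ᵇ 0 then 0# else ι (mult μ k) * term b c z t (π , μ)

  a : (b c : ℕ → Carrier) (z t : Carrier) → ℕ → ℕ → Carrier
  a b c z t i j with quotIndex i j
  ... | just r = b i * pow z r + c i * pow t r
  ... | nothing = 0#

  aOdd : (b : ℕ → Carrier) (z : Carrier) → ℕ → ℕ → Carrier
  aOdd b z s j with quotIndex s j
  ... | just r = b s * pow z r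
  ... | nothing = 0#

  aEven : (c : ℕ → Carrier) (t : Carrier) → ℕ → ℕ → Carrier
  aEven c t s j = aOdd c t s j

  conv : (b c : ℕ → Carrier) (z t : Carrier) → (ℕ → Carrier) → ℕ → Carrier
  conv b c z t f n = sumL (map (λ j → f j * P b c z t (n ℕ.∸ j)) (map suc (upTo n)))

{-# OPTIONS --safe #-}
-- Let G(q) = Σ_n P(n) q^n be the product of the factors (1 − z q^i)^(−b_i) and (1 − t q^i)^(−c_i).
-- Weighting each pair by r_s amounts to replacing the factor Σ_r g(r) q^(r s) of part s by
-- Σ_r r g(r) q^(r s), and the coefficients g(r) = (b_s)_r z^r / r! obey r g(r) = Σ_{i ≥ 1} b_s z^i g(r − i)
-- (the logarithmic derivative of (1 − z x)^(−b_s)).  So the weighted series is (Σ_{r ≥ 1} b_s z^r q^(r s)) G(q),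
-- whose n-th coefficient is Σ_j a_{2s−1}(j) P(n − j); the same holds for t, and (a) is the sum of the two.
module Submission where

open import Defs
open import Algebra.Bundles using (CommutativeRing)
open import Data.Nat as ℕ using (ℕ; zero; suc; _∸_; _≤_; _<_; z≤n; s≤s; _≤ᵇ_; _≡ᵇ_; _!)
import Data.Nat.Properties as ℕ
open import Data.Bool using (true; false; if_then_else_; T)
open import Data.Bool.Properties using (T-≡)
open import Data.Empty using (⊥-elim)
open import Data.List using (List; []; _∷_; map; concatMap; foldr; upTo; applyUpTo; _++_)
import Data.List.Properties as List
open import Data.List.Membership.Propositional using (_∈_)
open import Data.List.Membership.Propositional.Properties using (∈-map⁺; ∈-map⁻; ∈-upTo⁺)
open import Data.List.Relation.Unary.Any using (here; there)
open import Data.Maybe using (Maybe; just; nothing)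
open import Data.Product using (_×_; _,_)
open import Data.Unit using (tt)
open import Data.Vec as Vec using (Vec)
open import Function using (_∘_; case_of_)
open import Function.Bundles using (Equivalence)
open import Relation.Binary.PropositionalEquality as ≡ using (_≡_; _≢_)
open import Relation.Nullary using (¬_; yes; no)

private variable
  m n : ℕ

≤⇒≤ᵇ≡true : m ≤ n → (m ≤ᵇ n) ≡ true
≤⇒≤ᵇ≡true = Equivalence.to T-≡ ∘ ℕ.≤⇒≤ᵇ

>⇒≤ᵇ≡false : n < m → (m ≤ᵇ n) ≡ false
>⇒≤ᵇ≡false {n} {m} n<m with m ≤ᵇ n in eq
... | true  = ⊥-elim (ℕ.<⇒≱ n<m (ℕ.≤ᵇ⇒≤ m n (≡.subst T (≡.sym eq) tt)))
... | false = ≡.refl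

≡ᵇ-refl : ∀ n → (n ≡ᵇ n) ≡ true
≡ᵇ-refl zero    = ≡.refl
≡ᵇ-refl (suc n) = ≡ᵇ-refl n

≢⇒≡ᵇ≡false : m ≢ n → (m ≡ᵇ n) ≡ false
≢⇒≡ᵇ≡false {m} {n} m≢n with m ≡ᵇ n in eq
... | true  = ⊥-elim (m≢n (ℕ.≡ᵇ⇒≡ m n (≡.subst T (≡.sym eq) tt)))
... | false = ≡.refl

m≤m*n : ∀ {n} → 1 ≤ n → ∀ m → m ≤ m ℕ.* n
m≤m*n 1≤n m = ℕ.m≤m*n m _ {{ℕ.>-nonZero 1≤n}}

≤∸⇒+≤ : ∀ {a b w} → a ≤ w → b ≤ w ∸ a → a ℕ.+ b ≤ w
≤∸⇒+≤ {a} {b} {w} a≤w b≤w∸a = ≡.subst (_≤ w) (ℕ.+-comm b a) (ℕ.m≤o∸n⇒m+n≤o b a≤w b≤w∸a)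

≰∸⇒<+ : ∀ {a b w} → ¬ (b ≤ w ∸ a) → w < a ℕ.+ b
≰∸⇒<+ {a} {b} {w} b≰w∸a = ℕ.≰⇒> λ a+b≤w → b≰w∸a (ℕ.m+n≤o⇒m≤o∸n b (≡.subst (_≤ w) (ℕ.+-comm a b) a+b≤w))

data QuotIndexSpec (i j : ℕ) : Maybe ℕ → Set where
  exact : ∀ r → 1 ≤ r → r ℕ.* i ≡ j → QuotIndexSpec i j (just r)
  none  : (∀ r → 1 ≤ r → r ℕ.* i ≢ j) → QuotIndexSpec i j nothing

-- The search inside quotIndex is local to Defs, so we characterise every function obeying its equations.
search-spec : ∀ i j {search : List ℕ → Maybe ℕ} →
  search [] ≡ nothing →
  (∀ r rs → search (r ∷ rs) ≡ (if r ℕ.* i ≡ᵇ j then just r else search rs)) →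
  ∀ rs → (∀ r → r ∈ rs → 1 ≤ r) → (∀ r → 1 ≤ r → r ℕ.* i ≡ j → r ∈ rs) →
  QuotIndexSpec i j (search rs)
search-spec i j search-[] search-∷ [] _ complete rewrite search-[] =
  none λ r 1≤r eq → case complete r 1≤r eq of λ ()
search-spec i j search-[] search-∷ (r ∷ rs) positive complete rewrite search-∷ r rs
  with r ℕ.* i ≡ᵇ j in eq
... | true  = exact r (positive r (here ≡.refl)) (ℕ.≡ᵇ⇒≡ _ _ (≡.subst T (≡.sym eq) tt))
... | false = search-spec i j search-[] search-∷ rs (λ r′ → positive r′ ∘ there) complete′
  where
  complete′ : ∀ r′ → 1 ≤ r′ → r′ ℕ.* i ≡ j → r′ ∈ rs
  complete′ r′ 1≤r′ eq′ with complete r′ 1≤r′ eq′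
  ... | here ≡.refl = ⊥-elim (≡.subst T eq (ℕ.≡⇒≡ᵇ _ _ eq′))
  ... | there r′∈rs = r′∈rs

quotIndex-spec : ∀ i j → 1 ≤ i → QuotIndexSpec i j (quotIndex i j)
quotIndex-spec i j 1≤i with map suc (upTo j) in candidates | search-spec i j ≡.refl (λ _ _ → ≡.refl)
... | rs | spec = spec rs positive complete
  where
  positive : ∀ r → r ∈ rs → 1 ≤ r
  positive r r∈rs with ∈-map⁻ suc (≡.subst (r ∈_) (≡.sym candidates) r∈rs)
  ... | _ , _ , ≡.refl = s≤s z≤n
  complete : ∀ r → 1 ≤ r → r ℕ.* i ≡ j → r ∈ rs
  complete (suc r) _ eq = ≡.subst (suc r ∈_) candidates
    (∈-map⁺ suc (∈-upTo⁺ (≡.subst (suc r ≤_) eq (m≤m*n 1≤i (suc r)))))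

module FiniteSums {c ℓ} (R : CommutativeRing c ℓ) where
  open CommutativeRing R hiding (zero)
  open import Relation.Binary.Reasoning.Setoid setoid
  open import Algebra.Properties.CommutativeSemigroup +-commutativeSemigroup using (interchange)
  open import Algebra.Properties.CommutativeSemigroup *-commutativeSemigroup using (x∙yz≈y∙xz)

  sum : List Carrier → Carrier
  sum = foldr _+_ 0#

  private variable
    A B : Set

  sum-map-cong : ∀ {f g : A → Carrier} xs → (∀ x → f x ≈ g x) → sum (map f xs) ≈ sum (map g xs)
  sum-map-cong []       f≈g = refl
  sum-map-cong (x ∷ xs) f≈g = +-cong (f≈g x) (sum-map-cong xs f≈g)

  sum-map-+ : ∀ (f g : A → Carrier) xs → sum (map (λ x → f x + g x) xs) ≈ sum (map f xs) + sum (map g xs)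
  sum-map-+ f g []       = sym (+-identityʳ 0#)
  sum-map-+ f g (x ∷ xs) = trans (+-congˡ (sum-map-+ f g xs)) (interchange _ _ _ _)

  sum-map-++ : ∀ (f : A → Carrier) xs ys → sum (map f (xs ++ ys)) ≈ sum (map f xs) + sum (map f ys)
  sum-map-++ f []       ys = sym (+-identityˡ _)
  sum-map-++ f (x ∷ xs) ys = trans (+-congˡ (sum-map-++ f xs ys)) (sym (+-assoc _ _ _))

  sum-map-concatMap : ∀ (f : B → Carrier) (g : A → List B) xs →
    sum (map f (concatMap g xs)) ≈ sum (map (λ x → sum (map f (g x))) xs)
  sum-map-concatMap f g []       = refl
  sum-map-concatMap f g (x ∷ xs) = trans (sum-map-++ f (g x) (concatMap g xs)) (+-congˡ (sum-map-concatMap f g xs))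

  *-distribʳ-sum-map : ∀ a (f : A → Carrier) xs → sum (map f xs) * a ≈ sum (map (λ x → f x * a) xs)
  *-distribʳ-sum-map a f []       = zeroˡ a
  *-distribʳ-sum-map a f (x ∷ xs) = trans (distribʳ a _ _) (+-congˡ (*-distribʳ-sum-map a f xs))

  ∑≤ : ℕ → (ℕ → Carrier) → Carrier
  ∑≤ n f = sum (applyUpTo f (suc n))

  syntax ∑≤ n (λ i → e) = ∑[ i ≤ n ] e

  sum-map-upTo : ∀ (f : ℕ → Carrier) n → sum (map f (upTo (suc n))) ≈ ∑≤ n f
  sum-map-upTo f n = reflexive (≡.cong sum (List.map-upTo f (suc n)))

  ∑-cong : ∀ n {f g : ℕ → Carrier} → (∀ i → i ≤ n → f i ≈ g i) → ∑≤ n f ≈ ∑≤ n g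
  ∑-cong zero    f≈g = +-congʳ (f≈g 0 z≤n)
  ∑-cong (suc n) f≈g = +-cong (f≈g 0 z≤n) (∑-cong n (λ i i≤n → f≈g (suc i) (s≤s i≤n)))

  ∑-zero : ∀ n {f : ℕ → Carrier} → (∀ i → i ≤ n → f i ≈ 0#) → ∑≤ n f ≈ 0#
  ∑-zero n f≈0 = trans (∑-cong n f≈0) (go n)
    where
    go : ∀ n → ∑[ i ≤ n ] 0# ≈ 0#
    go zero    = +-identityʳ 0#
    go (suc n) = trans (+-identityˡ _) (go n)

  ∑-distrib-+ : ∀ n (f g : ℕ → Carrier) → ∑[ i ≤ n ] (f i + g i) ≈ ∑≤ n f + ∑≤ n g
  ∑-distrib-+ zero    f g = trans (+-identityʳ _) (sym (+-cong (+-identityʳ _) (+-identityʳ _)))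
  ∑-distrib-+ (suc n) f g = trans (+-congˡ (∑-distrib-+ n (f ∘ suc) (g ∘ suc))) (interchange _ _ _ _)

  *-distribˡ-∑ : ∀ n a (f : ℕ → Carrier) → a * ∑≤ n f ≈ ∑[ i ≤ n ] (a * f i)
  *-distribˡ-∑ zero    a f = trans (distribˡ a (f 0) 0#) (+-congˡ (zeroʳ a))
  *-distribˡ-∑ (suc n) a f = trans (distribˡ a (f 0) _) (+-congˡ (*-distribˡ-∑ n a (f ∘ suc)))

  *-distribʳ-∑ : ∀ n a (f : ℕ → Carrier) → ∑≤ n f * a ≈ ∑[ i ≤ n ] (f i * a)
  *-distribʳ-∑ n a f = trans (*-comm _ a) (trans (*-distribˡ-∑ n a f) (∑-cong n (λ i _ → *-comm a (f i))))

  ∑-comm : ∀ n m (F : ℕ → ℕ → Carrier) → ∑[ i ≤ n ] ∑≤ m (F i) ≈ ∑[ j ≤ m ] ∑[ i ≤ n ] F i j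
  ∑-comm zero    m F = trans (+-identityʳ _) (∑-cong m {F 0} (λ j _ → sym (+-identityʳ _)))
  ∑-comm (suc n) m F = begin
    ∑≤ m (F 0) + ∑[ i ≤ n ] ∑≤ m (F (suc i))       ≈⟨ +-congˡ (∑-comm n m (F ∘ suc)) ⟩
    ∑≤ m (F 0) + ∑[ j ≤ m ] ∑[ i ≤ n ] F (suc i) j  ≈⟨ ∑-distrib-+ m (F 0) (λ j → ∑[ i ≤ n ] F (suc i) j) ⟨
    ∑[ j ≤ m ] (F 0 j + ∑[ i ≤ n ] F (suc i) j)     ∎

  ∑-suc : ∀ n (f : ℕ → Carrier) → ∑≤ (suc n) f ≈ ∑≤ n f + f (suc n)
  ∑-suc zero    f = trans (+-congˡ (+-identityʳ _)) (sym (+-congʳ (+-identityʳ _)))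
  ∑-suc (suc n) f = trans (+-congˡ (∑-suc n (f ∘ suc))) (sym (+-assoc _ _ _))

  ∑-extend : ∀ {n M} (f : ℕ → Carrier) → n ≤ M → (∀ i → n < i → i ≤ M → f i ≈ 0#) → ∑≤ n f ≈ ∑≤ M f
  ∑-extend f n≤M = go (ℕ.≤⇒≤′ n≤M)
    where
    go : ∀ {n M} → n ℕ.≤′ M → (∀ i → n < i → i ≤ M → f i ≈ 0#) → ∑≤ n f ≈ ∑≤ M f
    go (ℕ.≤′-reflexive ≡.refl) _    = refl
    go {n} {suc M} (ℕ.≤′-step n≤′M) zeros = begin
      ∑≤ n f              ≈⟨ go n≤′M (λ i n<i i≤M → zeros i n<i (ℕ.m≤n⇒m≤1+n i≤M)) ⟩
      ∑≤ M f              ≈⟨ +-identityʳ _ ⟨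
      ∑≤ M f + 0#         ≈⟨ +-congˡ (zeros (suc M) (s≤s (ℕ.≤′⇒≤ n≤′M)) ℕ.≤-refl) ⟨
      ∑≤ M f + f (suc M)  ≈⟨ ∑-suc M f ⟨
      ∑≤ (suc M) f        ∎

  ∑-reverse : ∀ n (f : ℕ → Carrier) → ∑≤ n f ≈ ∑[ i ≤ n ] f (n ∸ i)
  ∑-reverse zero    f = refl
  ∑-reverse (suc n) f = begin
    f 0 + ∑≤ n (f ∘ suc)                     ≈⟨ +-congˡ (∑-reverse n (f ∘ suc)) ⟩
    f 0 + ∑[ i ≤ n ] f (suc (n ∸ i))         ≈⟨ +-comm _ _ ⟩
    ∑[ i ≤ n ] f (suc (n ∸ i)) + f 0         ≈⟨ +-cong (∑-cong n λ i i≤n → reflexive (≡.cong f (≡.sym (ℕ.+-∸-assoc 1 i≤n))))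
                                                        (reflexive (≡.cong f (≡.sym (ℕ.n∸n≡0 n)))) ⟩
    ∑[ i ≤ n ] f (suc n ∸ i) + f (suc n ∸ suc n) ≈⟨ ∑-suc n (λ i → f (suc n ∸ i)) ⟨
    ∑[ i ≤ suc n ] f (suc n ∸ i)             ∎

  if-cong : ∀ b {x y} → x ≈ y → (if b then x else 0#) ≈ (if b then y else 0#)
  if-cong true  x≈y = x≈y
  if-cong false _   = refl

  if-true : ∀ {b} → b ≡ true → ∀ x → (if b then x else 0#) ≈ x
  if-true ≡.refl x = refl

  if-false : ∀ {b} → b ≡ false → ∀ x → (if b then x else 0#) ≈ 0#
  if-false ≡.refl x = refl

  if-*ʳ : ∀ b x y → (if b then x else 0#) * y ≈ (if b then x * y else 0#)
  if-*ʳ true  x y = refl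
  if-*ʳ false x y = zeroˡ y

  if-zero : ∀ b → (if b then 0# else 0#) ≈ 0#
  if-zero true  = refl
  if-zero false = refl

  ∑-indicator : ∀ n c (f : ℕ → Carrier) → ∑[ i ≤ n ] (if c ≡ᵇ i then f i else 0#) ≈ (if c ≤ᵇ n then f c else 0#)
  ∑-indicator zero    zero          f = +-identityʳ _
  ∑-indicator zero    (suc c)       f = +-identityʳ _
  ∑-indicator (suc n) zero          f = trans (+-congˡ (∑-zero n (λ i _ → refl))) (+-identityʳ _)
  ∑-indicator (suc n) (suc zero)    f = trans (+-identityˡ _) (∑-indicator n zero (f ∘ suc))
  ∑-indicator (suc n) (suc (suc c)) f = trans (+-identityˡ _) (∑-indicator n (suc c) (f ∘ suc))

  ∑-shift : ∀ n c (f : ℕ → Carrier) →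
    ∑[ m ≤ n ] (if c ≤ᵇ m then f m else 0#) ≈ (if c ≤ᵇ n then ∑[ m ≤ n ∸ c ] f (c ℕ.+ m) else 0#)
  ∑-shift n       zero          f = refl
  ∑-shift zero    (suc c)       f = +-identityʳ _
  ∑-shift (suc n) (suc zero)    f = trans (+-identityˡ _) (∑-shift n zero (f ∘ suc))
  ∑-shift (suc n) (suc (suc c)) f = trans (+-identityˡ _) (∑-shift n (suc c) (f ∘ suc))

  ∑-triangle : ∀ w (F : ℕ → ℕ → Carrier) →
    ∑[ r ≤ w ] ∑[ i ≤ r ] F i (r ∸ i) ≈ ∑[ i ≤ w ] ∑[ j ≤ w ] (if i ℕ.+ j ≤ᵇ w then F i j else 0#)
  ∑-triangle w F = begin
    ∑[ r ≤ w ] ∑[ i ≤ r ] F i (r ∸ i)                          ≈⟨ ∑-cong w extend-inner ⟩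
    ∑[ r ≤ w ] ∑[ i ≤ w ] (if i ≤ᵇ r then F i (r ∸ i) else 0#)  ≈⟨ ∑-comm w w guarded ⟩
    ∑[ i ≤ w ] ∑[ r ≤ w ] (if i ≤ᵇ r then F i (r ∸ i) else 0#)  ≈⟨ ∑-cong w (λ i _ → regroup i) ⟩
    ∑[ i ≤ w ] ∑[ j ≤ w ] (if i ℕ.+ j ≤ᵇ w then F i j else 0#)  ∎
    where
    guarded : ℕ → ℕ → Carrier
    guarded r i = if i ≤ᵇ r then F i (r ∸ i) else 0#
    extend-inner : ∀ r → r ≤ w → ∑[ i ≤ r ] F i (r ∸ i) ≈ ∑[ i ≤ w ] (if i ≤ᵇ r then F i (r ∸ i) else 0#)
    extend-inner r r≤w = trans (∑-cong r inside) (∑-extend _ r≤w outside)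
      where
      inside : ∀ i → i ≤ r → F i (r ∸ i) ≈ (if i ≤ᵇ r then F i (r ∸ i) else 0#)
      inside i i≤r rewrite ≤⇒≤ᵇ≡true i≤r = refl
      outside : ∀ i → r < i → i ≤ w → (if i ≤ᵇ r then F i (r ∸ i) else 0#) ≈ 0#
      outside i r<i _ rewrite >⇒≤ᵇ≡false r<i = refl
    regroup : ∀ i → ∑[ r ≤ w ] guarded r i ≈ ∑[ j ≤ w ] (if i ℕ.+ j ≤ᵇ w then F i j else 0#)
    regroup i = trans (∑-shift w i (λ r → F i (r ∸ i))) (shifted i)
      where
      shifted : ∀ i → (if i ≤ᵇ w then ∑[ j ≤ w ∸ i ] F i (i ℕ.+ j ∸ i) else 0#)
                      ≈ ∑[ j ≤ w ] (if i ℕ.+ j ≤ᵇ w then F i j else 0#)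
      shifted i with i ℕ.≤? w
      ... | yes i≤w rewrite ≤⇒≤ᵇ≡true i≤w = trans (∑-cong (w ∸ i) inside) (∑-extend _ (ℕ.m∸n≤m w i) outside)
        where
        inside : ∀ j → j ≤ w ∸ i → F i (i ℕ.+ j ∸ i) ≈ (if i ℕ.+ j ≤ᵇ w then F i j else 0#)
        inside j j≤w∸i rewrite ≤⇒≤ᵇ≡true (≤∸⇒+≤ i≤w j≤w∸i) | ℕ.m+n∸m≡n i j = refl
        outside : ∀ j → w ∸ i < j → j ≤ w → (if i ℕ.+ j ≤ᵇ w then F i j else 0#) ≈ 0#
        outside j w∸i<j _ rewrite >⇒≤ᵇ≡false (≰∸⇒<+ {i} {j} {w} (ℕ.<⇒≱ w∸i<j)) = refl
      ... | no i≰w rewrite >⇒≤ᵇ≡false (ℕ.≰⇒> i≰w) = sym (∑-zero w vanish)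
        where
        vanish : ∀ j → j ≤ w → (if i ℕ.+ j ≤ᵇ w then F i j else 0#) ≈ 0#
        vanish j _ rewrite >⇒≤ᵇ≡false (ℕ.<-≤-trans (ℕ.≰⇒> i≰w) (ℕ.m≤m+n i j)) = refl

  _⋆_ : (ℕ → Carrier) → (ℕ → Carrier) → ℕ → Carrier
  (f ⋆ g) n = ∑[ i ≤ n ] (f i * g (n ∸ i))

  ⋆-comm : ∀ f g n → (f ⋆ g) n ≈ (g ⋆ f) n
  ⋆-comm f g n = trans (∑-reverse n (λ i → f i * g (n ∸ i))) (∑-cong n swap)
    where
    swap : ∀ i → i ≤ n → f (n ∸ i) * g (n ∸ (n ∸ i)) ≈ g i * f (n ∸ i)
    swap i i≤n rewrite ℕ.m∸[m∸n]≡n i≤n = *-comm _ _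

  ⋆-cong : ∀ {f f′ g g′ : ℕ → Carrier} n → (∀ m → m ≤ n → f m ≈ f′ m) → (∀ m → m ≤ n → g m ≈ g′ m) →
    (f ⋆ g) n ≈ (f′ ⋆ g′) n
  ⋆-cong {f} {f′} {g} {g′} n f≈f′ g≈g′ = ∑-cong n {λ i → f i * g (n ∸ i)} {λ i → f′ i * g′ (n ∸ i)}
    (λ i i≤n → *-cong (f≈f′ i i≤n) (g≈g′ (n ∸ i) (ℕ.m∸n≤m n i)))

  ⋆-congˡ : ∀ {f f′ : ℕ → Carrier} g n → (∀ m → m ≤ n → f m ≈ f′ m) → (f ⋆ g) n ≈ (f′ ⋆ g) n
  ⋆-congˡ g n f≈f′ = ⋆-cong {g = g} n f≈f′ (λ _ _ → refl)

  -- (a ⋆[ k ] x) w is the coefficient of q^w in (Σ_r a_r q^(r k)) · (Σ_m x_m q^m).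
  stretchTerm : ℕ → (a x : ℕ → Carrier) → (w r : ℕ) → Carrier
  stretchTerm k a x w r = if r ℕ.* k ≤ᵇ w then a r * x (w ∸ r ℕ.* k) else 0#

  _⋆[_]_ : (ℕ → Carrier) → ℕ → (ℕ → Carrier) → ℕ → Carrier
  (a ⋆[ k ] x) w = ∑≤ w (stretchTerm k a x w)

  ⋆[]-congˡ : ∀ k {a b : ℕ → Carrier} x w → (∀ r → a r ≈ b r) → (a ⋆[ k ] x) w ≈ (b ⋆[ k ] x) w
  ⋆[]-congˡ k {a} {b} x w a≈b =
    ∑-cong w {stretchTerm k a x w} {stretchTerm k b x w} (λ r _ → if-cong (r ℕ.* k ≤ᵇ w) (*-congʳ (a≈b r)))

  ⋆[]-congʳ : ∀ k a {x y : ℕ → Carrier} w → (∀ m → m ≤ w → x m ≈ y m) → (a ⋆[ k ] x) w ≈ (a ⋆[ k ] y) w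
  ⋆[]-congʳ k a {x} {y} w x≈y = ∑-cong w {stretchTerm k a x w} {stretchTerm k a y w}
    (λ r _ → if-cong (r ℕ.* k ≤ᵇ w) (*-congˡ (x≈y _ (ℕ.m∸n≤m w (r ℕ.* k)))))

  ⋆[]-extend : ∀ {k} a x {w M} → 1 ≤ k → w ≤ M → (a ⋆[ k ] x) w ≈ ∑≤ M (stretchTerm k a x w)
  ⋆[]-extend {k} a x {w} {M} 1≤k w≤M = ∑-extend (stretchTerm k a x w) w≤M vanish
    where
    vanish : ∀ r → w < r → r ≤ M → stretchTerm k a x w r ≈ 0#
    vanish r w<r _ rewrite >⇒≤ᵇ≡false (ℕ.<-≤-trans w<r (m≤m*n 1≤k r)) = refl

  twoStretchTerm : ℕ → ℕ → (a b x : ℕ → Carrier) → (w r s : ℕ) → Carrier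
  twoStretchTerm k l a b x w r s =
    if r ℕ.* k ℕ.+ s ℕ.* l ≤ᵇ w then a r * (b s * x (w ∸ (r ℕ.* k ℕ.+ s ℕ.* l))) else 0#

  ⋆[]-⋆[]-expand : ∀ k l a b x w → 1 ≤ l →
    (a ⋆[ k ] (b ⋆[ l ] x)) w ≈ ∑[ r ≤ w ] ∑[ s ≤ w ] twoStretchTerm k l a b x w r s
  ⋆[]-⋆[]-expand k l a b x w 1≤l = ∑-cong w expand
    where
    expand : ∀ r → r ≤ w → stretchTerm k a (b ⋆[ l ] x) w r ≈ ∑[ s ≤ w ] twoStretchTerm k l a b x w r s
    expand r _ with r ℕ.* k ℕ.≤? w
    ... | yes rk≤w rewrite ≤⇒≤ᵇ≡true rk≤w = begin
      a r * (b ⋆[ l ] x) (w ∸ r ℕ.* k)  ≈⟨ *-congˡ (⋆[]-extend b x 1≤l (ℕ.m∸n≤m w (r ℕ.* k))) ⟩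
      a r * ∑≤ w inner                  ≈⟨ *-distribˡ-∑ w (a r) inner ⟩
      ∑[ s ≤ w ] (a r * inner s)        ≈⟨ ∑-cong w (λ s _ → merge s) ⟩
      ∑[ s ≤ w ] twoStretchTerm k l a b x w r s ∎
      where
      inner : ℕ → Carrier
      inner = stretchTerm l b x (w ∸ r ℕ.* k)
      merge : ∀ s → a r * inner s ≈ twoStretchTerm k l a b x w r s
      merge s with s ℕ.* l ℕ.≤? w ∸ r ℕ.* k
      ... | yes sl≤ rewrite ≤⇒≤ᵇ≡true sl≤ | ≤⇒≤ᵇ≡true (≤∸⇒+≤ rk≤w sl≤) | ℕ.∸-+-assoc w (r ℕ.* k) (s ℕ.* l) = refl
      ... | no sl≰ rewrite >⇒≤ᵇ≡false (ℕ.≰⇒> sl≰) | >⇒≤ᵇ≡false (≰∸⇒<+ {r ℕ.* k} sl≰) = zeroʳ _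
    ... | no rk≰w rewrite >⇒≤ᵇ≡false (ℕ.≰⇒> rk≰w) = sym (∑-zero w vanish)
      where
      vanish : ∀ s → s ≤ w → twoStretchTerm k l a b x w r s ≈ 0#
      vanish s _ rewrite >⇒≤ᵇ≡false (ℕ.<-≤-trans (ℕ.≰⇒> rk≰w) (ℕ.m≤m+n (r ℕ.* k) (s ℕ.* l))) = refl

  ⋆[]-comm : ∀ k l a b x w → 1 ≤ k → 1 ≤ l → (a ⋆[ k ] (b ⋆[ l ] x)) w ≈ (b ⋆[ l ] (a ⋆[ k ] x)) w
  ⋆[]-comm k l a b x w 1≤k 1≤l = begin
    (a ⋆[ k ] (b ⋆[ l ] x)) w                            ≈⟨ ⋆[]-⋆[]-expand k l a b x w 1≤l ⟩
    ∑[ r ≤ w ] ∑[ s ≤ w ] twoStretchTerm k l a b x w r s  ≈⟨ ∑-comm w w (twoStretchTerm k l a b x w) ⟩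
    ∑[ s ≤ w ] ∑[ r ≤ w ] twoStretchTerm k l a b x w r s  ≈⟨ ∑-cong w (λ s _ → ∑-cong w (λ r _ → flip r s)) ⟩
    ∑[ s ≤ w ] ∑[ r ≤ w ] twoStretchTerm l k b a x w s r  ≈⟨ ⋆[]-⋆[]-expand l k b a x w 1≤k ⟨
    (b ⋆[ l ] (a ⋆[ k ] x)) w                            ∎
    where
    flip : ∀ r s → twoStretchTerm k l a b x w r s ≈ twoStretchTerm l k b a x w s r
    flip r s rewrite ℕ.+-comm (r ℕ.* k) (s ℕ.* l) =
      if-cong (s ℕ.* l ℕ.+ r ℕ.* k ≤ᵇ w) (x∙yz≈y∙xz (a r) (b s) (x (w ∸ (s ℕ.* l ℕ.+ r ℕ.* k))))

  ⋆-⋆[]-assoc : ∀ k a g x w → 1 ≤ k → ((a ⋆ g) ⋆[ k ] x) w ≈ (a ⋆[ k ] (g ⋆[ k ] x)) w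
  ⋆-⋆[]-assoc k a g x w 1≤k = begin
    ((a ⋆ g) ⋆[ k ] x) w                                            ≈⟨ ∑-cong w distribute ⟩
    ∑[ r ≤ w ] ∑[ i ≤ r ] term i (r ∸ i)                            ≈⟨ ∑-triangle w term ⟩
    ∑[ i ≤ w ] ∑[ j ≤ w ] (if i ℕ.+ j ≤ᵇ w then term i j else 0#)  ≈⟨ ∑-cong w (λ i _ → ∑-cong w (λ j _ → split i j)) ⟩
    ∑[ i ≤ w ] ∑[ j ≤ w ] twoStretchTerm k k a g x w i j            ≈⟨ ⋆[]-⋆[]-expand k k a g x w 1≤k ⟨
    (a ⋆[ k ] (g ⋆[ k ] x)) w                                       ∎
    where
    term : ℕ → ℕ → Carrier
    term i j = if (i ℕ.+ j) ℕ.* k ≤ᵇ w then a i * (g j * x (w ∸ (i ℕ.+ j) ℕ.* k)) else 0#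
    distribute : ∀ r → r ≤ w → stretchTerm k (a ⋆ g) x w r ≈ ∑[ i ≤ r ] term i (r ∸ i)
    distribute r _ with r ℕ.* k ℕ.≤? w
    ... | yes rk≤w = begin
      stretchTerm k (a ⋆ g) x w r                      ≈⟨ if-true (≤⇒≤ᵇ≡true rk≤w) _ ⟩
      (a ⋆ g) r * x (w ∸ r ℕ.* k)                      ≈⟨ *-distribʳ-∑ r (x (w ∸ r ℕ.* k)) (λ i → a i * g (r ∸ i)) ⟩
      ∑[ i ≤ r ] ((a i * g (r ∸ i)) * x (w ∸ r ℕ.* k)) ≈⟨ ∑-cong r reassociate ⟩
      ∑[ i ≤ r ] term i (r ∸ i)                        ∎
      where
      reassociate : ∀ i → i ≤ r → (a i * g (r ∸ i)) * x (w ∸ r ℕ.* k) ≈ term i (r ∸ i)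
      reassociate i i≤r rewrite ℕ.m+[n∸m]≡n i≤r | ≤⇒≤ᵇ≡true rk≤w = *-assoc _ _ _
    ... | no rk≰w = trans (if-false (>⇒≤ᵇ≡false (ℕ.≰⇒> rk≰w)) _) (sym (∑-zero r vanish))
      where
      vanish : ∀ i → i ≤ r → term i (r ∸ i) ≈ 0#
      vanish i i≤r rewrite ℕ.m+[n∸m]≡n i≤r | >⇒≤ᵇ≡false (ℕ.≰⇒> rk≰w) = refl
    split : ∀ i j → (if i ℕ.+ j ≤ᵇ w then term i j else 0#) ≈ twoStretchTerm k k a g x w i j
    split i j with i ℕ.+ j ℕ.≤? w
    ... | yes i+j≤w rewrite ≤⇒≤ᵇ≡true i+j≤w | ℕ.*-distribʳ-+ k i j = refl
    ... | no i+j≰w rewrite >⇒≤ᵇ≡false (ℕ.≰⇒> i+j≰w)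
      | >⇒≤ᵇ≡false (≡.subst (w <_) (ℕ.*-distribʳ-+ k i j) (ℕ.<-≤-trans (ℕ.≰⇒> i+j≰w) (m≤m*n 1≤k (i ℕ.+ j)))) = refl

  ⋆[]-⋆-assoc : ∀ k a x y n → 1 ≤ k → ((a ⋆[ k ] x) ⋆ y) n ≈ (a ⋆[ k ] (x ⋆ y)) n
  ⋆[]-⋆-assoc k a x y n 1≤k = begin
    ((a ⋆[ k ] x) ⋆ y) n                    ≈⟨ ∑-cong n expand ⟩
    ∑[ m ≤ n ] ∑[ r ≤ n ] term m r          ≈⟨ ∑-comm n n term ⟩
    ∑[ r ≤ n ] ∑[ m ≤ n ] term m r          ≈⟨ ∑-cong n (λ r _ → regroup r) ⟩
    (a ⋆[ k ] (x ⋆ y)) n                    ∎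
    where
    term : ℕ → ℕ → Carrier
    term m r = if r ℕ.* k ≤ᵇ m then a r * (x (m ∸ r ℕ.* k) * y (n ∸ m)) else 0#
    expand : ∀ m → m ≤ n → (a ⋆[ k ] x) m * y (n ∸ m) ≈ ∑[ r ≤ n ] term m r
    expand m m≤n = begin
      (a ⋆[ k ] x) m * y (n ∸ m)                     ≈⟨ *-congʳ (⋆[]-extend a x 1≤k m≤n) ⟩
      ∑≤ n (stretchTerm k a x m) * y (n ∸ m)         ≈⟨ *-distribʳ-∑ n (y (n ∸ m)) (stretchTerm k a x m) ⟩
      ∑[ r ≤ n ] (stretchTerm k a x m r * y (n ∸ m)) ≈⟨ ∑-cong n (λ r _ → reassociate r) ⟩
      ∑[ r ≤ n ] term m r                            ∎
      where
      reassociate : ∀ r → stretchTerm k a x m r * y (n ∸ m) ≈ term m r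
      reassociate r = trans (if-*ʳ (r ℕ.* k ≤ᵇ m) _ _) (if-cong (r ℕ.* k ≤ᵇ m) (*-assoc (a r) _ _))
    regroup : ∀ r → ∑[ m ≤ n ] term m r ≈ stretchTerm k a (x ⋆ y) n r
    regroup r = begin
      ∑[ m ≤ n ] term m r                                                 ≈⟨ ∑-shift n (r ℕ.* k) (λ m → a r * (x (m ∸ r ℕ.* k) * y (n ∸ m))) ⟩
      (if r ℕ.* k ≤ᵇ n then ∑[ m ≤ n ∸ r ℕ.* k ] shiftedTerm m else 0#)   ≈⟨ if-cong (r ℕ.* k ≤ᵇ n) (∑-cong (n ∸ r ℕ.* k) cancel) ⟩
      (if r ℕ.* k ≤ᵇ n then ∑[ m ≤ n ∸ r ℕ.* k ] (a r * rest m) else 0#)  ≈⟨ if-cong (r ℕ.* k ≤ᵇ n) (*-distribˡ-∑ (n ∸ r ℕ.* k) (a r) rest) ⟨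
      stretchTerm k a (x ⋆ y) n r                                         ∎
      where
      shiftedTerm rest : ℕ → Carrier
      shiftedTerm m = a r * (x (r ℕ.* k ℕ.+ m ∸ r ℕ.* k) * y (n ∸ (r ℕ.* k ℕ.+ m)))
      rest m = x m * y (n ∸ r ℕ.* k ∸ m)
      cancel : ∀ m → m ≤ n ∸ r ℕ.* k → shiftedTerm m ≈ a r * rest m
      cancel m _ rewrite ℕ.m+n∸m≡n (r ℕ.* k) m | ℕ.∸-+-assoc n (r ℕ.* k) m = refl

  stretch : ℕ → (ℕ → Carrier) → ℕ → Carrier
  stretch k a j = ∑[ r ≤ j ] (if r ℕ.* k ≡ᵇ j then a r else 0#)

  ⋆[]-as-⋆ : ∀ k a y n → 1 ≤ k → (a ⋆[ k ] y) n ≈ (stretch k a ⋆ y) n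
  ⋆[]-as-⋆ k a y n 1≤k = sym (begin
    (stretch k a ⋆ y) n                   ≈⟨ ∑-cong n expand ⟩
    ∑[ j ≤ n ] ∑[ r ≤ n ] term j r        ≈⟨ ∑-comm n n term ⟩
    ∑[ r ≤ n ] ∑[ j ≤ n ] term j r        ≈⟨ ∑-cong n (λ r _ → ∑-indicator n (r ℕ.* k) (λ j → a r * y (n ∸ j))) ⟩
    (a ⋆[ k ] y) n                        ∎)
    where
    term : ℕ → ℕ → Carrier
    term j r = if r ℕ.* k ≡ᵇ j then a r * y (n ∸ j) else 0#
    expand : ∀ j → j ≤ n → stretch k a j * y (n ∸ j) ≈ ∑[ r ≤ n ] term j r
    expand j j≤n = begin
      stretch k a j * y (n ∸ j)                 ≈⟨ *-congʳ (∑-extend hit j≤n vanish) ⟩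
      ∑≤ n hit * y (n ∸ j)                      ≈⟨ *-distribʳ-∑ n (y (n ∸ j)) hit ⟩
      ∑[ r ≤ n ] (hit r * y (n ∸ j))            ≈⟨ ∑-cong n (λ r _ → if-*ʳ (r ℕ.* k ≡ᵇ j) (a r) (y (n ∸ j))) ⟩
      ∑[ r ≤ n ] term j r                       ∎
      where
      hit : ℕ → Carrier
      hit r = if r ℕ.* k ≡ᵇ j then a r else 0#
      vanish : ∀ r → j < r → r ≤ n → hit r ≈ 0#
      vanish r j<r _ rewrite ≢⇒≡ᵇ≡false (ℕ.>⇒≢ (ℕ.<-≤-trans j<r (m≤m*n 1≤k r))) = refl

module ProductCoefficients {c ℓ} (R : CommutativeRing c ℓ) where
  open CommutativeRing R hiding (zero)
  open FiniteSums R
  open import Relation.Binary.Reasoning.Setoid setoid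
  open import Algebra.Properties.CommutativeSemigroup *-commutativeSemigroup using (x∙yz≈y∙xz)

  -- g i r is the coefficient of x^r in the factor attached to part i; v lists multiplicities from part k on.
  weightBy : (ℕ → ℕ → Carrier) → ℕ → ∀ {len} → Vec ℕ len → Carrier
  weightBy g k Vec.[]       = 1#
  weightBy g k (r Vec.∷ rs) = g k r * weightBy g (suc k) rs

  -- the coefficient of q^w in  Π_{k ≤ i < k + len} Σ_r g i r q^(i r)
  prodCoeff : (ℕ → ℕ → Carrier) → (k len w : ℕ) → Carrier
  prodCoeff g k len w = sum (map (weightBy g k) (multVecs k len w))

  prodCoeff-suc : ∀ g k len w → prodCoeff g k (suc len) w ≈ (g k ⋆[ k ] prodCoeff g (suc k) len) w
  prodCoeff-suc g k len w = begin
    prodCoeff g k (suc len) w                     ≈⟨ sum-map-concatMap (weightBy g k) candidates (upTo (suc w)) ⟩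
    sum (map (λ r → sum (map (weightBy g k) (candidates r))) (upTo (suc w)))
                                                  ≈⟨ sum-map-cong (upTo (suc w)) factor ⟩
    sum (map (stretchTerm k (g k) (prodCoeff g (suc k) len) w) (upTo (suc w)))
                                                  ≈⟨ sum-map-upTo _ w ⟩
    (g k ⋆[ k ] prodCoeff g (suc k) len) w        ∎
    where
    candidates : ℕ → List (Vec ℕ (suc len))
    candidates r = if r ℕ.* k ≤ᵇ w then map (r Vec.∷_) (multVecs (suc k) len (w ∸ r ℕ.* k)) else []
    sum-map-∷ : ∀ r (vs : List (Vec ℕ len)) → sum (map (weightBy g k) (map (r Vec.∷_) vs)) ≈ g k r * sum (map (weightBy g (suc k)) vs)
    sum-map-∷ r []       = sym (zeroʳ _)
    sum-map-∷ r (v ∷ vs) = trans (+-congˡ (sum-map-∷ r vs)) (sym (distribˡ _ _ _))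
    factor : ∀ r → sum (map (weightBy g k) (candidates r)) ≈ stretchTerm k (g k) (prodCoeff g (suc k) len) w r
    factor r with r ℕ.* k ≤ᵇ w
    ... | true  = sum-map-∷ r (multVecs (suc k) len (w ∸ r ℕ.* k))
    ... | false = refl

  prodCoeff-empty : ∀ g h k l w → prodCoeff g k 0 w ≈ prodCoeff h l 0 w
  prodCoeff-empty g h k l zero    = refl
  prodCoeff-empty g h k l (suc w) = refl

  module _ (g : ℕ → ℕ → Carrier) (g-0 : ∀ i → g i 0 ≈ 1#) where

    prodCoeff-below : ∀ len k w → w < k → prodCoeff g k len w ≈ prodCoeff g k 0 w
    prodCoeff-below zero      k w w<k = refl
    prodCoeff-below (suc len) k w w<k = begin
      prodCoeff g k (suc len) w                      ≈⟨ prodCoeff-suc g k len w ⟩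
      (g k ⋆[ k ] prodCoeff g (suc k) len) w         ≈⟨ ∑-extend _ z≤n vanish ⟨
      g k 0 * prodCoeff g (suc k) len w + 0#         ≈⟨ +-identityʳ _ ⟩
      g k 0 * prodCoeff g (suc k) len w              ≈⟨ trans (*-congʳ (g-0 k)) (*-identityˡ _) ⟩
      prodCoeff g (suc k) len w                      ≈⟨ prodCoeff-below len (suc k) w (ℕ.m≤n⇒m≤1+n w<k) ⟩
      prodCoeff g (suc k) 0 w                        ≈⟨ prodCoeff-empty g g (suc k) k w ⟩
      prodCoeff g k 0 w                              ∎
      where
      vanish : ∀ r → 0 < r → r ≤ w → stretchTerm k (g k) (prodCoeff g (suc k) len) w r ≈ 0#
      vanish (suc r) _ _ rewrite >⇒≤ᵇ≡false {w} {suc r ℕ.* k} (ℕ.<-≤-trans w<k (ℕ.m≤m+n k (r ℕ.* k))) = refl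

    prodCoeff-length : ∀ len len′ k w → w < k ℕ.+ len → w < k ℕ.+ len′ → prodCoeff g k len w ≈ prodCoeff g k len′ w
    prodCoeff-length len len′ k w _ _ with w ℕ.<? k
    ... | yes w<k = trans (prodCoeff-below len k w w<k) (sym (prodCoeff-below len′ k w w<k))
    prodCoeff-length zero _ k w w<k+0 _ | no w≮k = ⊥-elim (w≮k (≡.subst (w <_) (ℕ.+-identityʳ k) w<k+0))
    prodCoeff-length (suc l) zero k w _ w<k+0 | no w≮k = ⊥-elim (w≮k (≡.subst (w <_) (ℕ.+-identityʳ k) w<k+0))
    prodCoeff-length (suc l) (suc l′) k w w<k+1+l w<k+1+l′ | no _ = begin
      prodCoeff g k (suc l) w                  ≈⟨ prodCoeff-suc g k l w ⟩
      (g k ⋆[ k ] prodCoeff g (suc k) l) w     ≈⟨ ⋆[]-congʳ k (g k) w shorter ⟩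
      (g k ⋆[ k ] prodCoeff g (suc k) l′) w    ≈⟨ prodCoeff-suc g k l′ w ⟨
      prodCoeff g k (suc l′) w                 ∎
      where
      shorter : ∀ m → m ≤ w → prodCoeff g (suc k) l m ≈ prodCoeff g (suc k) l′ m
      shorter m m≤w = prodCoeff-length l l′ (suc k) m
        (ℕ.≤-<-trans m≤w (≡.subst (w <_) (ℕ.+-suc k l) w<k+1+l))
        (ℕ.≤-<-trans m≤w (≡.subst (w <_) (ℕ.+-suc k l′) w<k+1+l′))

  mark : ℕ → (ℕ → Carrier) → (ℕ → ℕ → Carrier) → ℕ → ℕ → Carrier
  mark s h g i r = if i ≡ᵇ s then h r * g i r else g i r

  weightBy-mark-above : ∀ s h g k → s < k → ∀ {len} (v : Vec ℕ len) → weightBy (mark s h g) k v ≈ weightBy g k v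
  weightBy-mark-above s h g k s<k Vec.[]      = refl
  weightBy-mark-above s h g k s<k (r Vec.∷ v) rewrite ≢⇒≡ᵇ≡false {k} {s} (ℕ.>⇒≢ s<k) =
    *-congˡ (weightBy-mark-above s h g (suc k) (ℕ.m≤n⇒m≤1+n s<k) v)

  -- mult counts parts from 1, so the j-th entry of v (from 0) is part j + k.
  weightBy-mark : ∀ h g s j k → s ≡ j ℕ.+ k → ∀ {len} (v : Vec ℕ len) → j < len →
    weightBy (mark s h g) k v ≈ h (mult v (suc j)) * weightBy g k v
  weightBy-mark h g s zero k ≡.refl (r Vec.∷ v) _ rewrite ≡ᵇ-refl k =
    trans (*-congˡ (weightBy-mark-above k h g (suc k) (ℕ.n<1+n k) v)) (*-assoc _ _ _)
  weightBy-mark h g s (suc j) k s≡1+j+k (r Vec.∷ v) (s≤s j<len) rewrite ≢⇒≡ᵇ≡false {k} {s} (λ k≡s → ℕ.m≢1+n+m k (≡.trans k≡s s≡1+j+k)) =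
    trans (*-congˡ (weightBy-mark h g s j (suc k) (≡.trans s≡1+j+k (≡.sym (ℕ.+-suc j k))) v j<len)) (x∙yz≈y∙xz _ _ _)

  prodCoeff-mark-above : ∀ s h g k len w → s < k → prodCoeff (mark s h g) k len w ≈ prodCoeff g k len w
  prodCoeff-mark-above s h g k len w s<k = sum-map-cong (multVecs k len w) (weightBy-mark-above s h g k s<k)

  -- Factors of parts other than s commute with the a-factor (⋆[]-comm); at part s the recurrence
  -- turns the marked factor into a ⋆ g s, which splits off (⋆-⋆[]-assoc).
  prodCoeff-mark : ∀ g h a s → 1 ≤ s → (∀ r → h r * g s r ≈ (a ⋆ g s) r) →
    ∀ len k → 1 ≤ k → k ≤ s → s < k ℕ.+ len → ∀ w → prodCoeff (mark s h g) k len w ≈ (a ⋆[ s ] prodCoeff g k len) w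
  prodCoeff-mark g h a s 1≤s recurrence zero k _ k≤s s<k+0 w =
    ⊥-elim (ℕ.<⇒≱ (≡.subst (s <_) (ℕ.+-identityʳ k) s<k+0) k≤s)
  prodCoeff-mark g h a s 1≤s recurrence (suc l) k 1≤k k≤s s<k+1+l w with k ℕ.≟ s
  ... | yes ≡.refl = begin
    prodCoeff (mark k h g) k (suc l) w                      ≈⟨ prodCoeff-suc (mark k h g) k l w ⟩
    (mark k h g k ⋆[ k ] prodCoeff (mark k h g) (suc k) l) w
                                                           ≈⟨ ⋆[]-congˡ k (prodCoeff (mark k h g) (suc k) l) w marked ⟩
    ((λ r → h r * g k r) ⋆[ k ] prodCoeff (mark k h g) (suc k) l) w
                                                           ≈⟨ ⋆[]-congʳ k (λ r → h r * g k r) w (λ m _ → later-unmarked m) ⟩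
    ((λ r → h r * g k r) ⋆[ k ] prodCoeff g (suc k) l) w   ≈⟨ ⋆[]-congˡ k (prodCoeff g (suc k) l) w recurrence ⟩
    ((a ⋆ g k) ⋆[ k ] prodCoeff g (suc k) l) w             ≈⟨ ⋆-⋆[]-assoc k a (g k) (prodCoeff g (suc k) l) w 1≤k ⟩
    (a ⋆[ k ] (g k ⋆[ k ] prodCoeff g (suc k) l)) w        ≈⟨ ⋆[]-congʳ k a w (λ m _ → prodCoeff-suc g k l m) ⟨
    (a ⋆[ k ] prodCoeff g k (suc l)) w                     ∎
    where
    marked : ∀ r → mark k h g k r ≈ h r * g k r
    marked r rewrite ≡ᵇ-refl k = refl
    later-unmarked : ∀ m → prodCoeff (mark k h g) (suc k) l m ≈ prodCoeff g (suc k) l m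
    later-unmarked m = prodCoeff-mark-above k h g (suc k) l m (ℕ.n<1+n k)
  ... | no k≢s = begin
    prodCoeff (mark s h g) k (suc l) w                      ≈⟨ prodCoeff-suc (mark s h g) k l w ⟩
    (mark s h g k ⋆[ k ] prodCoeff (mark s h g) (suc k) l) w
                                                           ≈⟨ ⋆[]-congˡ k (prodCoeff (mark s h g) (suc k) l) w unmarked ⟩
    (g k ⋆[ k ] prodCoeff (mark s h g) (suc k) l) w        ≈⟨ ⋆[]-congʳ k (g k) w (λ m _ → induction m) ⟩
    (g k ⋆[ k ] (a ⋆[ s ] prodCoeff g (suc k) l)) w        ≈⟨ ⋆[]-comm k s (g k) a (prodCoeff g (suc k) l) w 1≤k 1≤s ⟩
    (a ⋆[ s ] (g k ⋆[ k ] prodCoeff g (suc k) l)) w        ≈⟨ ⋆[]-congʳ s a w (λ m _ → prodCoeff-suc g k l m) ⟨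
    (a ⋆[ s ] prodCoeff g k (suc l)) w                     ∎
    where
    k<s : k < s
    k<s = ℕ.≤∧≢⇒< k≤s k≢s
    s<1+k+l : s < suc k ℕ.+ l
    s<1+k+l = ≡.subst (s <_) (ℕ.+-suc k l) s<k+1+l
    unmarked : ∀ r → mark s h g k r ≈ g k r
    unmarked r rewrite ≢⇒≡ᵇ≡false k≢s = refl
    induction : ∀ m → prodCoeff (mark s h g) (suc k) l m ≈ (a ⋆[ s ] prodCoeff g (suc k) l) m
    induction = prodCoeff-mark g h a s 1≤s recurrence l (suc k) (s≤s z≤n) k<s s<1+k+l

  prodCoeff-mark-⋆ : ∀ g h a s y n → 1 ≤ s → s ≤ n → (∀ r → h r * g s r ≈ (a ⋆ g s) r) →
    (prodCoeff (mark s h g) 1 n ⋆ y) n ≈ (a ⋆[ s ] (prodCoeff g 1 n ⋆ y)) n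
  prodCoeff-mark-⋆ g h a s y n 1≤s s≤n recurrence = begin
    (prodCoeff (mark s h g) 1 n ⋆ y) n       ≈⟨ ⋆-congˡ y n (λ m _ → prodCoeff-mark g h a s 1≤s recurrence n 1 ℕ.≤-refl 1≤s (s≤s s≤n) m) ⟩
    ((a ⋆[ s ] prodCoeff g 1 n) ⋆ y) n       ≈⟨ ⋆[]-⋆-assoc s a (prodCoeff g 1 n) y n 1≤s ⟩
    (a ⋆[ s ] (prodCoeff g 1 n ⋆ y)) n       ∎

  sum-pairs : ∀ n (f : Vec ℕ n × Vec ℕ n → Carrier) (u v : Vec ℕ n → Carrier) → (∀ π μ → f (π , μ) ≈ u π * v μ) →
    sum (map f (pairs n)) ≈ ((λ m → sum (map u (partitions n m))) ⋆ (λ m → sum (map v (partitions n m)))) n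
  sum-pairs n f u v f≈u*v = begin
    sum (map f (pairs n))                                  ≈⟨ sum-map-concatMap f pairsSplitAt (upTo (suc n)) ⟩
    sum (map (λ m → sum (map f (pairsSplitAt m))) (upTo (suc n)))
                                                           ≈⟨ sum-map-cong (upTo (suc n)) factor ⟩
    sum (map (λ m → U m * V (n ∸ m)) (upTo (suc n)))       ≈⟨ sum-map-upTo (λ m → U m * V (n ∸ m)) n ⟩
    (U ⋆ V) n                                              ∎
    where
    U V : ℕ → Carrier
    U m = sum (map u (partitions n m))
    V m = sum (map v (partitions n m))
    pairsSplitAt : ℕ → List (Vec ℕ n × Vec ℕ n)
    pairsSplitAt m = concatMap (λ π → map (π ,_) (partitions n (n ∸ m))) (partitions n m)
    sum-map-pairWith : ∀ π μs → sum (map f (map (π ,_) μs)) ≈ u π * sum (map v μs)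
    sum-map-pairWith π []       = sym (zeroʳ _)
    sum-map-pairWith π (μ ∷ μs) = trans (+-cong (f≈u*v π μ) (sum-map-pairWith π μs)) (sym (distribˡ _ _ _))
    factor : ∀ m → sum (map f (pairsSplitAt m)) ≈ U m * V (n ∸ m)
    factor m = begin
      sum (map f (pairsSplitAt m))                        ≈⟨ sum-map-concatMap f (λ π → map (π ,_) (partitions n (n ∸ m))) (partitions n m) ⟩
      sum (map (λ π → sum (map f (map (π ,_) (partitions n (n ∸ m))))) (partitions n m))
                                                          ≈⟨ sum-map-cong (partitions n m) (λ π → sum-map-pairWith π (partitions n (n ∸ m))) ⟩
      sum (map (λ π → u π * V (n ∸ m)) (partitions n m))  ≈⟨ *-distribʳ-sum-map (V (n ∸ m)) u (partitions n m) ⟨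
      U m * V (n ∸ m)                                     ∎

module Coefficients {c ℓ} (R : CommutativeRing c ℓ) (invFact : ℕ → CommutativeRing.Carrier R) where
  open CommutativeRing R hiding (zero)
  open WithRing R invFact
  open FiniteSums R
  open ProductCoefficients R
  open import Relation.Binary.Reasoning.Setoid setoid
  open import Algebra.Properties.CommutativeSemigroup *-commutativeSemigroup using (x∙yz≈y∙xz)

  ι-+ : ∀ m n → ι (m ℕ.+ n) ≈ ι m + ι n
  ι-+ zero    n = sym (+-identityˡ _)
  ι-+ (suc m) n = trans (+-congˡ (ι-+ m n)) (sym (+-assoc _ _ _))

  ι-* : ∀ m n → ι (m ℕ.* n) ≈ ι m * ι n
  ι-* zero    n = sym (zeroˡ _)
  ι-* (suc m) n = begin
    ι (n ℕ.+ m ℕ.* n)      ≈⟨ ι-+ n (m ℕ.* n) ⟩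
    ι n + ι (m ℕ.* n)      ≈⟨ +-cong (sym (*-identityˡ _)) (ι-* m n) ⟩
    1# * ι n + ι m * ι n   ≈⟨ distribʳ _ _ _ ⟨
    (1# + ι m) * ι n       ∎

  pow-+ : ∀ x m n → pow x (m ℕ.+ n) ≈ pow x m * pow x n
  pow-+ x zero    n = sym (*-identityˡ _)
  pow-+ x (suc m) n = trans (*-congˡ (pow-+ x m n)) (sym (*-assoc _ _ _))

  -- the coefficients of x (d/dx) log (1 − z x)^(−β) = Σ_{r ≥ 1} β z^r x^r
  logDerivCoeff : Carrier → Carrier → ℕ → Carrier
  logDerivCoeff β z zero    = 0#
  logDerivCoeff β z (suc r) = β * pow z (suc r)

  aOdd≈stretch : ∀ b z s j → 1 ≤ s → aOdd b z s j ≈ stretch s (logDerivCoeff (b s) z) j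
  aOdd≈stretch b z s j 1≤s with quotIndex s j | quotIndex-spec s j 1≤s
  ... | just (suc r) | exact .(suc r) _ ≡.refl = sym (begin
    ∑[ q ≤ suc r ℕ.* s ] (if q ℕ.* s ≡ᵇ suc r ℕ.* s then A q else 0#)  ≈⟨ ∑-cong (suc r ℕ.* s) (λ q _ → cancel q) ⟩
    ∑[ q ≤ suc r ℕ.* s ] (if suc r ≡ᵇ q then A q else 0#)            ≈⟨ ∑-indicator (suc r ℕ.* s) (suc r) A ⟩
    (if suc r ≤ᵇ suc r ℕ.* s then A (suc r) else 0#)                  ≈⟨ if-true (≤⇒≤ᵇ≡true (m≤m*n 1≤s (suc r))) (A (suc r)) ⟩
    b s * pow z (suc r)                                               ∎)
    where
    A : ℕ → Carrier
    A = logDerivCoeff (b s) z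
    cancel : ∀ q → (if q ℕ.* s ≡ᵇ suc r ℕ.* s then A q else 0#) ≈ (if suc r ≡ᵇ q then A q else 0#)
    cancel q with q ℕ.≟ suc r
    ... | yes ≡.refl rewrite ≡ᵇ-refl (suc r ℕ.* s) | ≡ᵇ-refl r = refl
    ... | no q≢1+r rewrite ≢⇒≡ᵇ≡false (q≢1+r ∘ ℕ.*-cancelʳ-≡ q (suc r) s {{ℕ.>-nonZero 1≤s}})
                         | ≢⇒≡ᵇ≡false (q≢1+r ∘ ≡.sym) = refl
  ... | nothing | none no-quotient = sym (∑-zero j vanish)
    where
    vanish : ∀ q → q ≤ j → (if q ℕ.* s ≡ᵇ j then logDerivCoeff (b s) z q else 0#) ≈ 0#
    vanish zero    _ = if-zero (0 ≡ᵇ j)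
    vanish (suc q) _ rewrite ≢⇒≡ᵇ≡false (no-quotient (suc q) (s≤s z≤n)) = refl

  conv≈⋆P : ∀ b c z t f n → f 0 ≈ 0# → conv b c z t f n ≈ (f ⋆ P b c z t) n
  conv≈⋆P b c z t f n f0≈0 = begin
    conv b c z t f n                        ≈⟨ reflexive (≡.cong sum (≡.trans (≡.sym (List.map-∘ (upTo n))) (List.map-upTo (summand ∘ suc) n))) ⟩
    sum (applyUpTo (summand ∘ suc) n)       ≈⟨ +-identityˡ _ ⟨
    0# + sum (applyUpTo (summand ∘ suc) n)  ≈⟨ +-congʳ (trans (*-congʳ f0≈0) (zeroˡ _)) ⟨
    (f ⋆ P b c z t) n                       ∎
    where
    summand : ℕ → Carrier
    summand j = f j * P b c z t (n ∸ j)

  conv-aOdd : ∀ b c z t b′ z′ s n → 1 ≤ s → conv b c z t (aOdd b′ z′ s) n ≈ (logDerivCoeff (b′ s) z′ ⋆[ s ] P b c z t) n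
  conv-aOdd b c z t b′ z′ s n 1≤s = begin
    conv b c z t (aOdd b′ z′ s) n                       ≈⟨ conv≈⋆P b c z t (aOdd b′ z′ s) n refl ⟩
    (aOdd b′ z′ s ⋆ P b c z t) n                        ≈⟨ ⋆-congˡ (P b c z t) n (λ j _ → aOdd≈stretch b′ z′ s j 1≤s) ⟩
    (stretch s (logDerivCoeff (b′ s) z′) ⋆ P b c z t) n ≈⟨ ⋆[]-as-⋆ s (logDerivCoeff (b′ s) z′) (P b c z t) n 1≤s ⟨
    (logDerivCoeff (b′ s) z′ ⋆[ s ] P b c z t) n        ∎

  conv-+ : ∀ b c z t f g h n → (∀ j → f j ≈ g j + h j) → conv b c z t f n ≈ conv b c z t g n + conv b c z t h n
  conv-+ b c z t f g h n f≈g+h = trans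
    (sum-map-cong (map suc (upTo n)) (λ j → trans (*-congʳ (f≈g+h j)) (distribʳ _ _ _)))
    (sum-map-+ (λ j → g j * P b c z t (n ∸ j)) (λ j → h j * P b c z t (n ∸ j)) (map suc (upTo n)))

  a≈aOdd+aOdd : ∀ b c z t i j → a b c z t i j ≈ aOdd b z i j + aOdd c t i j
  a≈aOdd+aOdd b c z t i j with quotIndex i j
  ... | just r  = refl
  ... | nothing = sym (+-identityʳ 0#)

  risingOverFact : Carrier → ℕ → Carrier
  risingOverFact β r = rising β r * invFact r

  -- the coefficient of x^r in (1 − z x)^(−β), given that invFact r is 1/r!
  negBinomCoeff : Carrier → Carrier → ℕ → Carrier
  negBinomCoeff β z r = risingOverFact β r * pow z r

  factorCoeff : (ℕ → Carrier) → Carrier → ℕ → ℕ → Carrier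
  factorCoeff b z i = negBinomCoeff (b i) z

  weight≡weightBy : ∀ b z k {len} (v : Vec ℕ len) → weight b z k v ≡ weightBy (factorCoeff b z) k v
  weight≡weightBy b z k Vec.[]      = ≡.refl
  weight≡weightBy b z k (r Vec.∷ v) = ≡.cong (factorCoeff b z k r *_) (weight≡weightBy b z (suc k) v)

  term≈weightBy*weightBy : ∀ b c z t {n} (π μ : Vec ℕ n) →
    term b c z t (π , μ) ≈ weightBy (factorCoeff b z) 1 π * weightBy (factorCoeff c t) 1 μ
  term≈weightBy*weightBy b c z t π μ = reflexive (≡.cong₂ _*_ (weight≡weightBy b z 1 π) (weight≡weightBy c t 1 μ))

  module _ (ι-!-inverse : ∀ r → ι (r !) * invFact r ≈ 1#) where
    open import Algebra.Properties.CommutativeSemigroup *-commutativeSemigroup using (interchange)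

    invFact-zero : invFact 0 ≈ 1#
    invFact-zero = trans (sym (trans (*-congʳ (+-identityʳ 1#)) (*-identityˡ _))) (ι-!-inverse 0)

    invFact-suc : ∀ r → ι (suc r) * invFact (suc r) ≈ invFact r
    invFact-suc r = begin
      ι (suc r) * invFact (suc r)                             ≈⟨ *-identityʳ _ ⟨
      (ι (suc r) * invFact (suc r)) * 1#                      ≈⟨ *-congˡ (ι-!-inverse r) ⟨
      (ι (suc r) * invFact (suc r)) * (ι (r !) * invFact r)   ≈⟨ trans (interchange _ _ _ _) (sym (*-assoc _ _ _)) ⟩
      ((ι (suc r) * ι (r !)) * invFact (suc r)) * invFact r   ≈⟨ *-congʳ (*-congʳ (ι-* (suc r) (r !))) ⟨
      (ι (suc r !) * invFact (suc r)) * invFact r             ≈⟨ *-congʳ (ι-!-inverse (suc r)) ⟩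
      1# * invFact r                                          ≈⟨ *-identityˡ _ ⟩
      invFact r                                               ∎

    negBinomCoeff-zero : ∀ β z → negBinomCoeff β z 0 ≈ 1#
    negBinomCoeff-zero β z = trans (*-identityʳ _) (trans (*-identityˡ _) invFact-zero)

    risingOverFact-suc : ∀ β r → ι (suc r) * risingOverFact β (suc r) ≈ (β + ι r) * risingOverFact β r
    risingOverFact-suc β r = begin
      ι (suc r) * ((rising β r * (β + ι r)) * invFact (suc r))   ≈⟨ x∙yz≈y∙xz _ _ _ ⟩
      (rising β r * (β + ι r)) * (ι (suc r) * invFact (suc r))   ≈⟨ *-congˡ (invFact-suc r) ⟩
      (rising β r * (β + ι r)) * invFact r                       ≈⟨ *-congʳ (*-comm _ _) ⟩
      ((β + ι r) * rising β r) * invFact r                       ≈⟨ *-assoc _ _ _ ⟩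
      (β + ι r) * risingOverFact β r                             ∎

    -- (r+1) u_{r+1} = (β + r) u_r telescopes to (r+1) u_{r+1} = β (u_0 + … + u_r).
    risingOverFact-sum : ∀ β r → ι (suc r) * risingOverFact β (suc r) ≈ β * ∑≤ r (risingOverFact β)
    risingOverFact-sum β zero = begin
      ι 1 * u 1             ≈⟨ risingOverFact-suc β 0 ⟩
      (β + 0#) * u 0        ≈⟨ *-cong (+-identityʳ β) (sym (+-identityʳ _)) ⟩
      β * ∑≤ 0 u            ∎
      where u = risingOverFact β
    risingOverFact-sum β (suc r) = begin
      ι (suc (suc r)) * u (suc (suc r))        ≈⟨ risingOverFact-suc β (suc r) ⟩
      (β + ι (suc r)) * u (suc r)              ≈⟨ distribʳ _ _ _ ⟩
      β * u (suc r) + ι (suc r) * u (suc r)    ≈⟨ +-congˡ (risingOverFact-sum β r) ⟩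
      β * u (suc r) + β * ∑≤ r u               ≈⟨ trans (+-comm _ _) (sym (distribˡ _ _ _)) ⟩
      β * (∑≤ r u + u (suc r))                 ≈⟨ *-congˡ (∑-suc r u) ⟨
      β * ∑≤ (suc r) u                         ∎
      where u = risingOverFact β

    negBinomCoeff-recurrence : ∀ β z r → ι r * negBinomCoeff β z r ≈ (logDerivCoeff β z ⋆ negBinomCoeff β z) r
    negBinomCoeff-recurrence β z zero = trans (zeroˡ _) (sym (trans (+-identityʳ _) (zeroˡ _)))
    negBinomCoeff-recurrence β z (suc r) = begin
      ι (suc r) * (u (suc r) * pow z (suc r))          ≈⟨ *-assoc _ _ _ ⟨
      (ι (suc r) * u (suc r)) * pow z (suc r)          ≈⟨ *-congʳ (risingOverFact-sum β r) ⟩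
      (β * ∑≤ r u) * pow z (suc r)                     ≈⟨ trans (*-assoc _ _ _) (trans (*-congˡ (*-comm _ _)) (sym (*-assoc _ _ _))) ⟩
      (β * pow z (suc r)) * ∑≤ r u                     ≈⟨ *-congˡ (∑-reverse r u) ⟩
      (β * pow z (suc r)) * ∑[ i ≤ r ] u (r ∸ i)       ≈⟨ *-distribˡ-∑ r _ (λ i → u (r ∸ i)) ⟩
      ∑[ i ≤ r ] ((β * pow z (suc r)) * u (r ∸ i))     ≈⟨ ∑-cong r split ⟨
      ∑[ i ≤ r ] (A (suc i) * g (r ∸ i))               ≈⟨ +-identityˡ _ ⟨
      0# + ∑[ i ≤ r ] (A (suc i) * g (r ∸ i))          ≈⟨ +-congʳ (zeroˡ _) ⟨
      (A ⋆ g) (suc r)                                  ∎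
      where
      u = risingOverFact β
      A = logDerivCoeff β z
      g = negBinomCoeff β z
      split : ∀ i → i ≤ r → A (suc i) * g (r ∸ i) ≈ (β * pow z (suc r)) * u (r ∸ i)
      split i i≤r = begin
        (β * pow z (suc i)) * (u (r ∸ i) * pow z (r ∸ i))   ≈⟨ *-congˡ (*-comm _ _) ⟩
        (β * pow z (suc i)) * (pow z (r ∸ i) * u (r ∸ i))   ≈⟨ *-assoc _ _ _ ⟨
        ((β * pow z (suc i)) * pow z (r ∸ i)) * u (r ∸ i)   ≈⟨ *-congʳ (*-assoc _ _ _) ⟩
        (β * (pow z (suc i) * pow z (r ∸ i))) * u (r ∸ i)   ≈⟨ *-congʳ (*-congˡ (pow-+ z (suc i) (r ∸ i))) ⟨
        (β * pow z (suc i ℕ.+ (r ∸ i))) * u (r ∸ i)         ≡⟨ ≡.cong (λ e → (β * pow z (suc e)) * u (r ∸ i)) (ℕ.m+[n∸m]≡n i≤r) ⟩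
        (β * pow z (suc r)) * u (r ∸ i)                     ∎

    factorCoeff-zero : ∀ b z i → factorCoeff b z i 0 ≈ 1#
    factorCoeff-zero b z i = negBinomCoeff-zero (b i) z

    P-factorises : ∀ b c z t N n → N ≤ n →
      P b c z t N ≈ (prodCoeff (factorCoeff b z) 1 n ⋆ prodCoeff (factorCoeff c t) 1 n) N
    P-factorises b c z t N n N≤n =
      trans (sum-pairs N (term b c z t) (weightBy (factorCoeff b z) 1) (weightBy (factorCoeff c t) 1) (term≈weightBy*weightBy b c z t))
            (⋆-cong N (lengthen b z) (lengthen c t))
      where
      lengthen : ∀ b z m → m ≤ N → prodCoeff (factorCoeff b z) 1 N m ≈ prodCoeff (factorCoeff b z) 1 n m
      lengthen b z m m≤N = prodCoeff-length (factorCoeff b z) (factorCoeff-zero b z) N n 1 m (s≤s m≤N) (s≤s (ℕ.≤-trans m≤N N≤n))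

    ι*-unless-zero : ∀ m x → (if m ≡ᵇ 0 then 0# else ι m * x) ≈ ι m * x
    ι*-unless-zero zero    x = sym (zeroˡ x)
    ι*-unless-zero (suc m) x = refl

    Fz-factorises : ∀ b c z t s n → 1 ≤ s → s ≤ n →
      Fz b c z t s n ≈ (prodCoeff (mark s ι (factorCoeff b z)) 1 n ⋆ prodCoeff (factorCoeff c t) 1 n) n
    Fz-factorises b c z t (suc j) n _ s≤n = sum-pairs n _ (weightBy (mark (suc j) ι (factorCoeff b z)) 1) (weightBy (factorCoeff c t) 1) marked
      where
      marked : ∀ π μ → (if mult π (suc j) ≡ᵇ 0 then 0# else ι (mult π (suc j)) * term b c z t (π , μ))
                       ≈ weightBy (mark (suc j) ι (factorCoeff b z)) 1 π * weightBy (factorCoeff c t) 1 μ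
      marked π μ = begin
        _                                                        ≈⟨ ι*-unless-zero (mult π (suc j)) _ ⟩
        ι (mult π (suc j)) * term b c z t (π , μ)                ≈⟨ *-congˡ (term≈weightBy*weightBy b c z t π μ) ⟩
        ι (mult π (suc j)) * (weightBy (factorCoeff b z) 1 π * weightBy (factorCoeff c t) 1 μ)
                                                                 ≈⟨ *-assoc _ _ _ ⟨
        (ι (mult π (suc j)) * weightBy (factorCoeff b z) 1 π) * weightBy (factorCoeff c t) 1 μ
                                                                 ≈⟨ *-congʳ (weightBy-mark ι (factorCoeff b z) (suc j) j 1 (ℕ.+-comm 1 j) π s≤n) ⟨
        weightBy (mark (suc j) ι (factorCoeff b z)) 1 π * weightBy (factorCoeff c t) 1 μ ∎

    Ft-factorises : ∀ b c z t s n → 1 ≤ s → s ≤ n →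
      Ft b c z t s n ≈ (prodCoeff (factorCoeff b z) 1 n ⋆ prodCoeff (mark s ι (factorCoeff c t)) 1 n) n
    Ft-factorises b c z t (suc j) n _ s≤n = sum-pairs n _ (weightBy (factorCoeff b z) 1) (weightBy (mark (suc j) ι (factorCoeff c t)) 1) marked
      where
      marked : ∀ π μ → (if mult μ (suc j) ≡ᵇ 0 then 0# else ι (mult μ (suc j)) * term b c z t (π , μ))
                       ≈ weightBy (factorCoeff b z) 1 π * weightBy (mark (suc j) ι (factorCoeff c t)) 1 μ
      marked π μ = begin
        _                                                        ≈⟨ ι*-unless-zero (mult μ (suc j)) _ ⟩
        ι (mult μ (suc j)) * term b c z t (π , μ)                ≈⟨ *-congˡ (term≈weightBy*weightBy b c z t π μ) ⟩
        ι (mult μ (suc j)) * (weightBy (factorCoeff b z) 1 π * weightBy (factorCoeff c t) 1 μ)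
                                                                 ≈⟨ x∙yz≈y∙xz _ _ _ ⟩
        weightBy (factorCoeff b z) 1 π * (ι (mult μ (suc j)) * weightBy (factorCoeff c t) 1 μ)
                                                                 ≈⟨ *-congˡ (weightBy-mark ι (factorCoeff c t) (suc j) j 1 (ℕ.+-comm 1 j) μ s≤n) ⟨
        weightBy (factorCoeff b z) 1 π * weightBy (mark (suc j) ι (factorCoeff c t)) 1 μ ∎

    Fz≈conv-aOdd : ∀ b c z t s n → 1 ≤ s → s ≤ n → Fz b c z t s n ≈ conv b c z t (aOdd b z s) n
    Fz≈conv-aOdd b c z t s n 1≤s s≤n = begin
      Fz b c z t s n                                          ≈⟨ Fz-factorises b c z t s n 1≤s s≤n ⟩
      (prodCoeff (mark s ι (factorCoeff b z)) 1 n ⋆ Qc) n     ≈⟨ prodCoeff-mark-⋆ (factorCoeff b z) ι A s Qc n 1≤s s≤n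
                                                                   (negBinomCoeff-recurrence (b s) z) ⟩
      (A ⋆[ s ] (Qb ⋆ Qc)) n                                  ≈⟨ ⋆[]-congʳ s A n (λ m m≤n → P-factorises b c z t m n m≤n) ⟨
      (A ⋆[ s ] P b c z t) n                                  ≈⟨ conv-aOdd b c z t b z s n 1≤s ⟨
      conv b c z t (aOdd b z s) n                             ∎
      where
      A = logDerivCoeff (b s) z
      Qb = prodCoeff (factorCoeff b z) 1 n
      Qc = prodCoeff (factorCoeff c t) 1 n

    Ft≈conv-aEven : ∀ b c z t s n → 1 ≤ s → s ≤ n → Ft b c z t s n ≈ conv b c z t (aEven c t s) n
    Ft≈conv-aEven b c z t s n 1≤s s≤n = begin
      Ft b c z t s n                                          ≈⟨ Ft-factorises b c z t s n 1≤s s≤n ⟩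
      (Qb ⋆ prodCoeff (mark s ι (factorCoeff c t)) 1 n) n     ≈⟨ ⋆-comm Qb (prodCoeff (mark s ι (factorCoeff c t)) 1 n) n ⟩
      (prodCoeff (mark s ι (factorCoeff c t)) 1 n ⋆ Qb) n     ≈⟨ prodCoeff-mark-⋆ (factorCoeff c t) ι A s Qb n 1≤s s≤n
                                                                   (negBinomCoeff-recurrence (c s) t) ⟩
      (A ⋆[ s ] (Qc ⋆ Qb)) n                                  ≈⟨ ⋆[]-congʳ s A n P-factorises-swapped ⟨
      (A ⋆[ s ] P b c z t) n                                  ≈⟨ conv-aOdd b c z t c t s n 1≤s ⟨
      conv b c z t (aEven c t s) n                            ∎
      where
      A = logDerivCoeff (c s) t
      Qb = prodCoeff (factorCoeff b z) 1 n
      Qc = prodCoeff (factorCoeff c t) 1 n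
      P-factorises-swapped : ∀ m → m ≤ n → P b c z t m ≈ (Qc ⋆ Qb) m
      P-factorises-swapped m m≤n = trans (P-factorises b c z t m n m≤n) (⋆-comm Qb Qc m)

    Fz+Ft≈conv-a : ∀ b c z t i n → 1 ≤ i → i ≤ n → Fz b c z t i n + Ft b c z t i n ≈ conv b c z t (a b c z t i) n
    Fz+Ft≈conv-a b c z t i n 1≤i i≤n = begin
      Fz b c z t i n + Ft b c z t i n                             ≈⟨ +-cong (Fz≈conv-aOdd b c z t i n 1≤i i≤n) (Ft≈conv-aEven b c z t i n 1≤i i≤n) ⟩
      conv b c z t (aOdd b z i) n + conv b c z t (aOdd c t i) n   ≈⟨ conv-+ b c z t _ _ _ n (a≈aOdd+aOdd b c z t i) ⟨
      conv b c z t (a b c z t i) n                                ∎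

theorem2p5 : ∀ {c ℓ} (R : CommutativeRing c ℓ) (invFact : ℕ → CommutativeRing.Carrier R) →
    let open CommutativeRing R
        open WithRing R invFact
    in (∀ r → ι (r !) * invFact r ≈ 1#) →
       (b c : ℕ → Carrier) (z t : Carrier) (n : ℕ) → 1 ≤ n →
       ((i : ℕ) → 1 ≤ i → i ≤ n →
          Fz b c z t i n + Ft b c z t i n ≈ conv b c z t (a b c z t i) n)
       ×
       ((s : ℕ) → 1 ≤ s → s ≤ n →
          (Fz b c z t s n ≈ conv b c z t (aOdd b z s) n)
          × (Ft b c z t s n ≈ conv b c z t (aEven c t s) n))
theorem2p5 R invFact ι-!-inverse b c z t n _ =
  (λ i 1≤i i≤n → Fz+Ft≈conv-a ι-!-inverse b c z t i n 1≤i i≤n) ,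
  (λ s 1≤s s≤n → Fz≈conv-aOdd ι-!-inverse b c z t s n 1≤s s≤n , Ft≈conv-aEven ι-!-inverse b c z t s n 1≤s s≤n)
  where open Coefficients R invFact
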